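{- Let $I$ be a well-ordered set, $S\subseteq\prod_{i\in I}\{0,1\}$, and $J$ a finite subset of $I$. Then $\operatorname{ev}_{S_J}(E(S_J))$ spans $C(S_J,\mathbb{Z})$ as an abelian group.
   Context: Write $X=\prod_{i\in I}\{0,1\}$ (product topology), $x_i$ the $i$-th coordinate. For $J\subseteq I$, $\pi_J:X\to X$ has $\pi_J(x)_i=x_i$ for $i\in J$ and $0$ otherwise; $S_J=\pi_J(S)$. For $T\subseteq X$ and $i\in I$, $e_{T,i}\in C(T,\mathbb{Z})$ is $x\mapsto x_i$. $P$ is the set of finite strictly decreasing sequences in $I$ (including the empty one), ordered lexicographically (empty sequence smallest; compare first entries, and if equal compare tails). $\operatorname{ev}_T:P\to C(T,\mathbb{Z})$ sends $(i_1,\dots,i_r)$ to $e_{T,i_1}\cdots e_{T,i_r}$. $E(T)=\{p\in P: \operatorname{ev}_T(p)\notin\operatorname{span}_{\mathbb{Z}}\operatorname{ev}_T(\{q\in P:q<p\})\}$. -}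

module Defs where

open import Level using (0ℓ)
open import Data.Bool using (Bool; true; false; if_then_else_)
open import Data.Integer using (ℤ; _+_; _*_; 0ℤ; 1ℤ)
open import Data.List using (List; []; _∷_; foldr)
open import Data.List.Relation.Unary.All using (All)
open import Data.List.Relation.Unary.Linked using (Linked)
open import Data.List.Relation.Binary.Lex.Strict using (Lex-<)
open import Data.Product using (Σ; ∃; _×_; _,_; proj₁; proj₂)
open import Relation.Binary using (Rel; IsStrictTotalOrder)
open import Relation.Binary.PropositionalEquality using (_≡_)
open import Relation.Nullary using (¬_; does)
open import Induction.WellFounded using (WellFounded)

record WellOrderedSet : Set₁ where
  field
    Carrier            : Set
    _<_                : Rel Carrier 0ℓ
    isStrictTotalOrder : IsStrictTotalOrder _≡_ _<_
    wellFounded        : WellFounded _<_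

module WO (W : WellOrderedSet) where
  open WellOrderedSet W renaming (Carrier to I) public
  open IsStrictTotalOrder isStrictTotalOrder using (_≟_)
  open import Data.List.Membership.DecPropositional _≟_ using (_∈_; _∈?_) public

  -- X = ∏_{i∈I} {0,1}, coordinates as Booleans (false = 0, true = 1)
  X : Set
  X = I → Bool

  bit : Bool → ℤ
  bit b = if b then 1ℤ else 0ℤ

  π : List I → X → X
  π J x i = if does (i ∈? J) then x i else false

  image : List I → (X → Set) → X → Set
  image J S y = ∃ λ x → S x × (∀ i → π J x i ≡ y i)

  Decreasing : List I → Set
  Decreasing = Linked (λ a b → b < a)

  P : Set
  P = Σ (List I) Decreasing

  _<P_ : P → P → Set
  p <P q = Lex-< _≡_ _<_ (proj₁ p) (proj₁ q)

  -- ev(i₁,…,i_r) = e_{i₁} ⋯ e_{i_r} (as a function on X; ev_T is its restriction to T)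
  ev : P → X → ℤ
  ev p x = foldr (λ i r → bit (x i) * r) 1ℤ (proj₁ p)

  lincomb : List (ℤ × P) → X → ℤ
  lincomb cs x = foldr (λ cq r → proj₁ cq * ev (proj₂ cq) x + r) 0ℤ cs

  InSpan : (T : X → Set) → (Q : P → Set) → (X → ℤ) → Set
  InSpan T Q g = ∃ λ (cs : List (ℤ × P)) →
    All (λ cq → Q (proj₂ cq)) cs × (∀ y → T y → g y ≡ lincomb cs y)

  E : (X → Set) → P → Set
  E T p = ¬ InSpan T (λ q → q <P p) (ev p)

  -- f restricted to T is continuous T → ℤ (ℤ discrete, product topology):
  -- locally constant w.r.t. basic cylinder neighbourhoods
  ContinuousOn : (X → Set) → (X → ℤ) → Set
  ContinuousOn T f = ∀ y → T y → ∃ λ (F : List I) →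
    ∀ z → T z → (∀ i → i ∈ F → z i ≡ y i) → f z ≡ f y

{-# OPTIONS --safe #-}
module Submission where

-- Every function on T = S_J determined by the coordinates in a finite list K lies in the
-- ℤ-span of all monomials: split on the first coordinate k, g = e_k g₁ + (1 − e_k) g₀,
-- where g_b agrees with g on the points of T with x_k = b and is determined by the
-- remaining coordinates.  A continuous f on S_J is determined by J, since every point of
-- S_J vanishes off J.  Finally every monomial ev p lies in the span of ev(E(T)): either
-- p ∈ E(T), or ev p is a combination of lexicographically smaller monomials, and the
-- lexicographic order on decreasing sequences of a well-order is well-founded.

open import Defs
open import Level using (Level; 0ℓ)
open import Data.Bool using (Bool; true; false; if_then_else_)
open import Data.Integer using (ℤ; _+_; _*_; 0ℤ; 1ℤ; -1ℤ)
open import Data.Integer.Properties using (+-identityˡ; +-identityʳ; +-assoc; *-identityˡ; *-identityʳ; *-zeroʳ)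
open import Data.Integer.Tactic.RingSolver using (solve-∀)
open import Data.List using (List; []; _∷_; _++_; map; foldr)
open import Data.List.Relation.Unary.All using (All; []; _∷_; universal)
open import Data.List.Relation.Unary.All.Properties using (++⁺; map⁺)
open import Data.List.Relation.Unary.Any using (here; there)
open import Data.List.Relation.Unary.Linked as Linked using (Linked; []; [-]; _∷_)
open import Data.List.Relation.Binary.Lex.Core using (base; this; next)
open import Data.List.Relation.Binary.Lex.Strict using (Lex-<)
open import Data.Product using (Σ; ∃; _×_; _,_; proj₁; proj₂)
open import Data.Unit using (⊤; tt)
open import Data.Empty using (⊥-elim)
open import Function using (_∘_)
open import Axiom.ExcludedMiddle using (ExcludedMiddle)
open import Relation.Binary using (Rel; IsStrictTotalOrder; tri<; tri≈; tri>)
open import Relation.Binary.PropositionalEquality using (_≡_; refl; sym; trans; cong; cong₂)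
open import Relation.Nullary using (¬_; Dec; yes; no)
open import Induction.WellFounded using (WellFounded; Acc; acc)

module DecreasingLex {a ℓ : Level} {A : Set a} (_<_ : Rel A ℓ) where

  DecreasingList : Set (a Level.⊔ ℓ)
  DecreasingList = Σ (List A) (Linked (λ x y → y < x))

  _<Lex_ : Rel DecreasingList (a Level.⊔ ℓ)
  p <Lex q = Lex-< _≡_ _<_ (proj₁ p) (proj₁ q)

  acc-[] : ∀ d → Acc _<Lex_ ([] , d)
  acc-[] d = acc λ { (base ()) }

  acc-∷ : ∀ {i} → Acc _<_ i → ∀ t d → Acc _<Lex_ (i ∷ t , d)
  acc-∷ {i} (acc rs) t d = go t d (tail-acc t d)
    where
    smaller-head : ∀ {j} → j < i → ∀ s e → Acc _<Lex_ (j ∷ s , e)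
    smaller-head j<i = acc-∷ (rs j<i)

    tail-acc : ∀ t (d : Linked (λ x y → y < x) (i ∷ t)) → Acc _<Lex_ (t , Linked.tail d)
    tail-acc []      d         = acc-[] (Linked.tail d)
    tail-acc (k ∷ t) (k<i ∷ d) = smaller-head k<i t d

    go : ∀ t d → Acc _<Lex_ (t , Linked.tail d) → Acc _<Lex_ (i ∷ t , d)
    go t d (acc below-t) = acc below
      where
      below : ∀ {q} → q <Lex (i ∷ t , d) → Acc _<Lex_ q
      below {[] , e}     _               = acc-[] e
      below {j ∷ s , e}  (this j<i)      = smaller-head j<i s e
      below {.i ∷ s , e} (next refl s<t) = go s e (below-t s<t)

  <Lex-wellFounded : WellFounded _<_ → WellFounded _<Lex_
  <Lex-wellFounded wf ([] , d)    = acc-[] d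
  <Lex-wellFounded wf (i ∷ t , d) = acc-∷ (wf i) t d

module DecreasingInsert {a ℓ : Level} {A : Set a} {_<_ : Rel A ℓ}
                        (sto : IsStrictTotalOrder _≡_ _<_) where
  open IsStrictTotalOrder sto using (compare)

  Decreasing : List A → Set (a Level.⊔ ℓ)
  Decreasing = Linked (λ x y → y < x)

  insert : A → List A → List A
  insert k [] = k ∷ []
  insert k (j ∷ t) with compare k j
  ... | tri< _ _ _ = j ∷ insert k t
  ... | tri≈ _ _ _ = j ∷ t
  ... | tri> _ _ _ = k ∷ j ∷ t

  insert-below-head : ∀ {j k} t → Decreasing (j ∷ t) → k < j → Decreasing (j ∷ insert k t)
  insert-below-head []      _          k<j = k<j ∷ [-]
  insert-below-head {k = k} (m ∷ t) (m<j ∷ d) k<j with compare k m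
  ... | tri< k<m _ _ = m<j ∷ insert-below-head t d k<m
  ... | tri≈ _ _ _   = m<j ∷ d
  ... | tri> _ _ m<k = k<j ∷ m<k ∷ d

  insert-decreasing : ∀ k t → Decreasing t → Decreasing (insert k t)
  insert-decreasing k []      _ = [-]
  insert-decreasing k (m ∷ t) d with compare k m
  ... | tri< k<m _ _ = insert-below-head t d k<m
  ... | tri≈ _ _ _   = d
  ... | tri> _ _ m<k = m<k ∷ d

module _ (W : WellOrderedSet) where
  open WO W
  open DecreasingLex _<_ using (<Lex-wellFounded)
  open DecreasingInsert isStrictTotalOrder using (insert; insert-decreasing)
  open IsStrictTotalOrder isStrictTotalOrder using (compare)

  <P-wellFounded : WellFounded _<P_
  <P-wellFounded = <Lex-wellFounded wellFounded

  monomial : List I → X → ℤ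
  monomial l x = foldr (λ i r → bit (x i) * r) 1ℤ l

  bit-absorb : ∀ b r → bit b * (bit b * r) ≡ bit b * r
  bit-absorb true  r = *-identityˡ (1ℤ * r)
  bit-absorb false r = refl

  monomial-insert : ∀ k t x → monomial (insert k t) x ≡ bit (x k) * monomial t x
  monomial-insert k []      x = refl
  monomial-insert k (m ∷ t) x with compare k m
  ... | tri< _ _ _ = trans (cong (bit (x m) *_) (monomial-insert k t x))
                           (commute (bit (x m)) (bit (x k)) (monomial t x))
    where
    commute : ∀ u v w → u * (v * w) ≡ v * (u * w)
    commute = solve-∀
  ... | tri≈ _ refl _ = sym (bit-absorb (x k) (monomial t x))
  ... | tri> _ _ _    = refl

  insertP : I → P → P
  insertP k (t , d) = insert k t , insert-decreasing k t d

  ev-insertP : ∀ k p x → ev (insertP k p) x ≡ bit (x k) * ev p x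
  ev-insertP k p = monomial-insert k (proj₁ p)

  lincomb-++ : ∀ cs ds x → lincomb (cs ++ ds) x ≡ lincomb cs x + lincomb ds x
  lincomb-++ []              ds x = sym (+-identityˡ _)
  lincomb-++ ((c , q) ∷ cs) ds x =
    trans (cong (c * ev q x +_) (lincomb-++ cs ds x))
          (sym (+-assoc (c * ev q x) (lincomb cs x) (lincomb ds x)))

  scaleCoeffs : ℤ → List (ℤ × P) → List (ℤ × P)
  scaleCoeffs c = map (λ (d , q) → c * d , q)

  lincomb-scale : ∀ c cs x → lincomb (scaleCoeffs c cs) x ≡ c * lincomb cs x
  lincomb-scale c []             x = sym (*-zeroʳ c)
  lincomb-scale c ((d , q) ∷ cs) x =
    trans (cong (c * d * ev q x +_) (lincomb-scale c cs x))
          (distrib c d (ev q x) (lincomb cs x))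
    where
    distrib : ∀ c d e r → c * d * e + c * r ≡ c * (d * e + r)
    distrib = solve-∀

  module _ {T : X → Set} {Q : P → Set} where

    span-resp : ∀ {g h} → (∀ y → T y → g y ≡ h y) → InSpan T Q g → InSpan T Q h
    span-resp g≡h (cs , inQ , g≡cs) = cs , inQ , λ y ty → trans (sym (g≡h y ty)) (g≡cs y ty)

    span-ev : ∀ p → Q p → InSpan T Q (ev p)
    span-ev p qp = (1ℤ , p) ∷ [] , qp ∷ [] , λ y _ → sym (trans (+-identityʳ _) (*-identityˡ (ev p y)))

    span-zero : InSpan T Q (λ _ → 0ℤ)
    span-zero = [] , [] , λ _ _ → refl

    span-+ : ∀ {g h} → InSpan T Q g → InSpan T Q h → InSpan T Q (λ x → g x + h x)
    span-+ (cs , inQ , g≡cs) (ds , inQ′ , h≡ds) =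
      cs ++ ds , ++⁺ inQ inQ′ ,
      λ y ty → trans (cong₂ _+_ (g≡cs y ty) (h≡ds y ty)) (sym (lincomb-++ cs ds y))

    span-scale : ∀ c {g} → InSpan T Q g → InSpan T Q (λ x → c * g x)
    span-scale c (cs , inQ , g≡cs) =
      scaleCoeffs c cs , map⁺ inQ ,
      λ y ty → trans (cong (c *_) (g≡cs y ty)) (sym (lincomb-scale c cs y))

    span-lincomb : ∀ {R : P → Set} cs → All (R ∘ proj₂) cs →
                   (∀ q → R q → InSpan T Q (ev q)) → InSpan T Q (lincomb cs)
    span-lincomb []             []         _    = span-zero
    span-lincomb ((c , q) ∷ cs) (rq ∷ inR) evQ =
      span-+ (span-scale c (evQ q rq)) (span-lincomb cs inR evQ)

  span-trans : ∀ {T Q R g} → (∀ q → R q → InSpan T Q (ev q)) → InSpan T R g → InSpan T Q g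
  span-trans evQ (cs , inR , g≡cs) = span-resp (λ y ty → sym (g≡cs y ty)) (span-lincomb cs inR evQ)

  Spanned : (X → Set) → (X → ℤ) → Set
  Spanned T = InSpan T (λ _ → ⊤)

  spanned-lincomb : ∀ {T} cs → Spanned T (lincomb cs)
  spanned-lincomb cs = cs , universal (λ _ → tt) cs , λ _ _ → refl

  spanned-mulBit : ∀ {T} k {g} → Spanned T g → Spanned T (λ x → bit (x k) * g x)
  spanned-mulBit k (cs , _ , g≡cs) =
    span-resp (λ y ty → sym (trans (cong (bit (y k) *_) (g≡cs y ty)) (mulBit-lincomb cs y)))
              (spanned-lincomb (map (λ (c , q) → c , insertP k q) cs))
    where
    distrib : ∀ b c e r → b * (c * e + r) ≡ c * (b * e) + b * r
    distrib = solve-∀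

    mulBit-lincomb : ∀ cs y → bit (y k) * lincomb cs y ≡ lincomb (map (λ (c , q) → c , insertP k q) cs) y
    mulBit-lincomb []             y = *-zeroʳ (bit (y k))
    mulBit-lincomb ((c , q) ∷ cs) y =
      trans (distrib (bit (y k)) c (ev q y) (lincomb cs y))
            (cong₂ (λ u v → c * u + v) (sym (ev-insertP k q y)) (mulBit-lincomb cs y))

  Agree : List I → X → X → Set
  Agree K y z = ∀ i → i ∈ K → y i ≡ z i

  DeterminedOn : (X → Set) → List I → (X → ℤ) → Set
  DeterminedOn T K g = ∀ y z → T y → T z → Agree K y z → g y ≡ g z

  module _ (em : ExcludedMiddle 0ℓ) (T : X → Set) where

    ev-span-E : ∀ p → InSpan T (E T) (ev p)
    ev-span-E p = go p (<P-wellFounded p)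
      where
      go : ∀ p → Acc _<P_ p → InSpan T (E T) (ev p)
      go p (acc below) with em {InSpan T (_<P p) (ev p)}
      ... | yes spanned-below = span-trans (λ q q<p → go q (below q<p)) spanned-below
      ... | no p∈E            = span-ev p p∈E

    -- g_b(y) is g z for any z ∈ T with z_k = b agreeing with y on K, and 0 if there is none.
    module Split (k : I) (K : List I) (g : X → ℤ) (det : DeterminedOn T (k ∷ K) g) (b : Bool) where

      Witness : X → Set
      Witness y = ∃ λ z → T z × Agree K z y × z k ≡ b

      valueAt : ∀ {y} → Dec (Witness y) → ℤ
      valueAt (yes (z , _)) = g z
      valueAt (no _)        = 0ℤ

      g-at : X → ℤ
      g-at y = valueAt (em {Witness y})

      agree-∷ : ∀ {z z′} → z k ≡ b → z′ k ≡ b → Agree K z z′ → Agree (k ∷ K) z z′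
      agree-∷ zk z′k _  _ (here refl) = trans zk (sym z′k)
      agree-∷ _  _   ag i (there i∈K) = ag i i∈K

      valueAt-resp : ∀ {y y′} (w : Dec (Witness y)) (w′ : Dec (Witness y′)) →
                     Agree K y y′ → valueAt w ≡ valueAt w′
      valueAt-resp (yes (z , tz , zy , zk)) (yes (z′ , tz′ , z′y′ , z′k)) yy′ =
        det z z′ tz tz′ (agree-∷ zk z′k λ i i∈K → trans (zy i i∈K) (trans (yy′ i i∈K) (sym (z′y′ i i∈K))))
      valueAt-resp (yes (z , tz , zy , zk)) (no none) yy′ =
        ⊥-elim (none (z , tz , (λ i i∈K → trans (zy i i∈K) (yy′ i i∈K)) , zk))
      valueAt-resp (no none) (yes (z′ , tz′ , z′y′ , z′k)) yy′ =
        ⊥-elim (none (z′ , tz′ , (λ i i∈K → trans (z′y′ i i∈K) (sym (yy′ i i∈K))) , z′k))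
      valueAt-resp (no _) (no _) _ = refl

      g-at-determined : DeterminedOn T K g-at
      g-at-determined y y′ _ _ = valueAt-resp em em

      g-at-agrees : ∀ y → T y → y k ≡ b → g-at y ≡ g y
      g-at-agrees y ty yk = agrees em
        where
        agrees : (w : Dec (Witness y)) → valueAt w ≡ g y
        agrees (yes (z , tz , zy , zk)) = det z y tz ty (agree-∷ zk yk zy)
        agrees (no none)                = ⊥-elim (none (y , ty , (λ _ _ → refl) , yk))

    recombine : ∀ b u v → bit b * u + (v + -1ℤ * (bit b * v)) ≡ (if b then u else v)
    recombine true  = chooseFirst
      where
      chooseFirst : ∀ u v → 1ℤ * u + (v + -1ℤ * (1ℤ * v)) ≡ u
      chooseFirst = solve-∀
    recombine false = chooseSecond
      where
      chooseSecond : ∀ u v → 0ℤ * u + (v + -1ℤ * (0ℤ * v)) ≡ v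
      chooseSecond = solve-∀

    determined-spanned : ∀ K g → DeterminedOn T K g → Spanned T g
    determined-spanned [] g det with em {∃ T}
    ... | yes (y₀ , ty₀) =
      span-resp (λ y ty → trans (*-identityʳ (g y₀)) (det y₀ y ty₀ ty λ _ ()))
                (span-scale (g y₀) (span-ev ([] , []) tt))
    ... | no empty = span-resp (λ y ty → ⊥-elim (empty (y , ty))) span-zero
    determined-spanned (k ∷ K) g det =
      span-resp split-correct
        (span-+ (spanned-mulBit k (g-at-spanned true))
                (span-+ (g-at-spanned false) (span-scale -1ℤ (spanned-mulBit k (g-at-spanned false)))))
      where
      module G = Split k K g det

      g-at-spanned : ∀ b → Spanned T (G.g-at b)
      g-at-spanned b = determined-spanned K (G.g-at b) (G.g-at-determined b)

      g₁ g₀ : X → ℤ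
      g₁ = G.g-at true
      g₀ = G.g-at false

      select : ∀ y → T y → (if y k then g₁ y else g₀ y) ≡ g y
      select y ty with y k in yk
      ... | true  = G.g-at-agrees true y ty yk
      ... | false = G.g-at-agrees false y ty yk

      split-correct : ∀ y → T y → bit (y k) * g₁ y + (g₀ y + -1ℤ * (bit (y k) * g₀ y)) ≡ g y
      split-correct y ty = trans (recombine (y k) (g₁ y) (g₀ y)) (select y ty)

  π-vanishes-off : ∀ J x i → ¬ i ∈ J → π J x i ≡ false
  π-vanishes-off J x i i∉J with i ∈? J
  ... | yes i∈J = ⊥-elim (i∉J i∈J)
  ... | no _    = refl

  image-vanishes-off : ∀ {J S y} → image J S y → ∀ i → ¬ i ∈ J → y i ≡ false
  image-vanishes-off {J} (x , _ , πx≡y) i i∉J = trans (sym (πx≡y i)) (π-vanishes-off J x i i∉J)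

  continuous-determined : ∀ J S f → ContinuousOn (image J S) f → DeterminedOn (image J S) J f
  continuous-determined J S f cont y z ty tz yz = proj₂ (cont z tz) y ty agree
    where
    -- On S_J, agreeing on J means agreeing everywhere, in particular on the neighbourhood.
    agree : ∀ i → i ∈ proj₁ (cont z tz) → y i ≡ z i
    agree i _ with i ∈? J
    ... | yes i∈J = yz i i∈J
    ... | no i∉J  = trans (image-vanishes-off ty i i∉J) (sym (image-vanishes-off tz i i∉J))

lemma4p11 : ExcludedMiddle 0ℓ → (W : WellOrderedSet) →
    let open WO W in
    (S : X → Set) (J : List I) (f : X → ℤ) →
    ContinuousOn (image J S) f →
    InSpan (image J S) (E (image J S)) f
lemma4p11 em W S J f cont =
  span-trans W (λ q _ → ev-span-E W em T q)
    (determined-spanned W em T J f (continuous-determined W J S f cont))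
  where
  T : WO.X W → Set
  T = WO.image W J S
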